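{- Let $\lambda X$ be a pure type system with specification $(\mathcal S,\mathcal A,\mathcal R)$ satisfying: for all $c$ and $s_1$, if $(c:s_1)\in\mathcal A$ then there are no $s_2,s_3$ with $(s_1,s_2,s_3)\in\mathcal R$. Then the Hilbert-style pure type system with specification $(\mathcal S,\mathcal A,\emptyset)$ is equivalent to $\lambda X$, and it is trivial in that its only theorems are its axioms, i.e. the judgements $\vdash c:s$ with $(c:s)\in\mathcal A$.
   Context: Pure type systems (PTS): variables, constants $\mathcal C$, sorts $\mathcal S\subseteq\mathcal C$, axioms $\mathcal A$ ($c:s$ with $c\in\mathcal C,s\in\mathcal S$), rules $\mathcal R\subseteq\mathcal S^3$; pseudoterms $\mathcal T::=V\mid\mathcal C\mid\Pi V{:}\mathcal T.\mathcal T\mid\lambda V{:}\mathcal T.\mathcal T\mid\mathcal T\mathcal T$; derivable judgements $\Gamma\vdash M:A$ are generated by (axiom) $\vdash c:s$ for $(c:s)\in\mathcal A$; (start) $\Gamma\vdash A:s\Rightarrow\Gamma,x:A\vdash x:A$ ($x$ fresh); (weakening) $\Gamma\vdash M:B$, $\Gamma\vdash A:s\Rightarrow\Gamma,x:A\vdash M:B$ ($x$ fresh); (application) $\Gamma\vdash M:\Pi x{:}A.B$, $\Gamma\vdash N:A\Rightarrow\Gamma\vdash MN:B[x:=N]$; (abstraction) $\Gamma,x:A\vdash M:B$, $\Gamma\vdash(\Pi x{:}A.B):s\Rightarrow\Gamma\vdash(\lambda x{:}A.M):(\Pi x{:}A.B)$; (product) $\Gamma,x:A\vdash B:s_2$,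 $\Gamma\vdash A:s_1$, $(s_1,s_2,s_3)\in\mathcal R\Rightarrow\Gamma\vdash(\Pi x{:}A.B):s_3$; (conversion) $\Gamma\vdash M:A$, $\Gamma\vdash B:s$, $A=_\beta B\Rightarrow\Gamma\vdash M:B$. A theorem is a derivable judgement with empty context. Hilbert-style PTS (HPTS) with specification $(\mathcal S,\mathcal A,\mathcal B)$: same pseudoterms, only empty contexts; derivable judgements generated by the axioms of $\mathcal A$ and of the finite set $\mathcal B$ of axiom schemes, (application) and (conversion) with empty contexts, (type reduction) $\vdash M:A$, $A\to_\beta B\Rightarrow\vdash M:B$, and (subject reduction) $\vdash M:A$, $M\to_\beta N\Rightarrow\vdash N:A$. It is equivalent to the PTS $(\mathcal S,\mathcal A,\mathcal R)$ if for all $M,A$, $\vdash M:A$ is derivable in one iff in the other. -}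

module Defs where

open import Data.Nat using (ℕ; zero; suc)
open import Data.List using (List; []; _∷_)
open import Data.Empty using (⊥)
open import Relation.Binary.Construct.Closure.Equivalence using (EqClosure)

record Spec : Set₁ where
  field
    Const   : Set
    IsSort  : Const → Set
    Axiom   : Const → Const → Set
    Rule    : Const → Const → Const → Set
    axiom-sort : ∀ {c s} → Axiom c s → IsSort s
    rule-sorts₁ : ∀ {s₁ s₂ s₃} → Rule s₁ s₂ s₃ → IsSort s₁
    rule-sorts₂ : ∀ {s₁ s₂ s₃} → Rule s₁ s₂ s₃ → IsSort s₂
    rule-sorts₃ : ∀ {s₁ s₂ s₃} → Rule s₁ s₂ s₃ → IsSort s₃

-- Pseudoterms (variables as de Bruijn indices; binders bind index 0
-- in the body).

module Terms (C : Set) where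

  data Term : Set where
    var : ℕ → Term
    con : C → Term
    Pi  : Term → Term → Term
    lam : Term → Term → Term
    app : Term → Term → Term

  ext : (ℕ → ℕ) → ℕ → ℕ
  ext ρ zero    = zero
  ext ρ (suc i) = suc (ρ i)

  rename : (ℕ → ℕ) → Term → Term
  rename ρ (var i)   = var (ρ i)
  rename ρ (con c)   = con c
  rename ρ (Pi A B)  = Pi (rename ρ A) (rename (ext ρ) B)
  rename ρ (lam A M) = lam (rename ρ A) (rename (ext ρ) M)
  rename ρ (app M N) = app (rename ρ M) (rename ρ N)

  wk : Term → Term
  wk = rename suc

  exts : (ℕ → Term) → ℕ → Term
  exts σ zero    = var zero
  exts σ (suc i) = wk (σ i)

  subst : (ℕ → Term) → Term → Term
  subst σ (var i)   = σ i
  subst σ (con c)   = con c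
  subst σ (Pi A B)  = Pi (subst σ A) (subst (exts σ) B)
  subst σ (lam A M) = lam (subst σ A) (subst (exts σ) M)
  subst σ (app M N) = app (subst σ M) (subst σ N)

  single : Term → ℕ → Term
  single N zero    = N
  single N (suc i) = var i

  _[_] : Term → Term → Term
  B [ N ] = subst (single N) B

  infix 4 _→β_
  data _→β_ : Term → Term → Set where
    beta  : ∀ {A M N} → app (lam A M) N →β M [ N ]
    Pi₁   : ∀ {A A' B} → A →β A' → Pi A B →β Pi A' B
    Pi₂   : ∀ {A B B'} → B →β B' → Pi A B →β Pi A B'
    lam₁  : ∀ {A A' M} → A →β A' → lam A M →β lam A' M
    lam₂  : ∀ {A M M'} → M →β M' → lam A M →β lam A M'
    app₁  : ∀ {M M' N} → M →β M' → app M N →β app M' N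
    app₂  : ∀ {M N N'} → N →β N' → app M N →β app M N'

  infix 4 _=β_
  _=β_ : Term → Term → Set
  _=β_ = EqClosure _→β_

  Context : Set
  Context = List Term   -- head = most recently added declaration

module PTS (𝒮 : Spec) where
  open Spec 𝒮
  open Terms Const public

  infix 3 _⊢_∶_
  data _⊢_∶_ : Context → Term → Term → Set where
    axiom : ∀ {c s} → Axiom c s → [] ⊢ con c ∶ con s
    start : ∀ {Γ A s} → IsSort s → Γ ⊢ A ∶ con s → (A ∷ Γ) ⊢ var zero ∶ wk A
    weakening : ∀ {Γ M B A s} → IsSort s → Γ ⊢ M ∶ B → Γ ⊢ A ∶ con s →
                (A ∷ Γ) ⊢ wk M ∶ wk B
    application : ∀ {Γ M N A B} → Γ ⊢ M ∶ Pi A B → Γ ⊢ N ∶ A →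
                  Γ ⊢ app M N ∶ B [ N ]
    abstraction : ∀ {Γ A M B s} → IsSort s → (A ∷ Γ) ⊢ M ∶ B →
                  Γ ⊢ Pi A B ∶ con s → Γ ⊢ lam A M ∶ Pi A B
    product : ∀ {Γ A B s₁ s₂ s₃} → (A ∷ Γ) ⊢ B ∶ con s₂ → Γ ⊢ A ∶ con s₁ →
              Rule s₁ s₂ s₃ → Γ ⊢ Pi A B ∶ con s₃
    conversion : ∀ {Γ M A B s} → IsSort s → Γ ⊢ M ∶ A → Γ ⊢ B ∶ con s →
                 A =β B → Γ ⊢ M ∶ B

-- Hilbert-style PTS with specification (𝒮, 𝒜, ℬ).  The set ℬ of axiom
-- schemes is given by the predicate `Scheme M A` ("⊢ M : A is an
-- instance of a scheme in ℬ"); the rules of 𝒮 are not used.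

module HPTS (𝒮 : Spec) (Scheme : Terms.Term (Spec.Const 𝒮) → Terms.Term (Spec.Const 𝒮) → Set) where
  open Spec 𝒮
  open Terms Const public

  infix 3 ⊢_∶_
  data ⊢_∶_ : Term → Term → Set where
    axiom : ∀ {c s} → Axiom c s → ⊢ con c ∶ con s
    scheme : ∀ {M A} → Scheme M A → ⊢ M ∶ A
    application : ∀ {M N A B} → ⊢ M ∶ Pi A B → ⊢ N ∶ A → ⊢ app M N ∶ B [ N ]
    conversion : ∀ {M A B s} → IsSort s → ⊢ M ∶ A → ⊢ B ∶ con s → A =β B →
                 ⊢ M ∶ B
    type-reduction : ∀ {M A B} → ⊢ M ∶ A → A →β B → ⊢ M ∶ B
    subject-reduction : ∀ {M N A} → ⊢ M ∶ A → M →β N → ⊢ N ∶ A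

NoSchemes : {C : Set} → Terms.Term C → Terms.Term C → Set
NoSchemes _ _ = ⊥

-- A closed PTS judgement is typed by a sort, so it cannot be the
-- conclusion of application or abstraction (whose types are Π-types), nor
-- of product (its domain would be an axiom constant whose sort heads a
-- rule, which the hypothesis forbids).  Conversion between sorts is trivial
-- because β-reduction is confluent and constants are normal forms.  Hence
-- every closed theorem is an axiom.  The same argument, without the product
-- case, applies to the Hilbert-style system without schemes, whose extra
-- reduction rules are vacuous on constants.
module Submission where

open import Defs
open import Data.List using ([])
open import Data.Nat using (zero; suc)
open import Data.Product using (Σ; ∃; _×_; _,_)
open import Data.Empty using (⊥-elim)
open import Function.Base using (_∘_)
open import Function.Bundles using (_⇔_; mk⇔)
open import Relation.Nullary using (¬_)
open import Relation.Binary.PropositionalEquality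
  using (_≡_; refl; sym; trans; cong; cong₂; module ≡-Reasoning)
open import Relation.Binary.Construct.Closure.ReflexiveTransitive
  using (Star; ε; _◅_; _◅◅_; gmap; map; _⋆)
open import Relation.Binary.Rewriting using (Confluent; IsNormalForm; conf⇒unf)

module _ {C : Set} where
  open Terms C

  ext-cong : ∀ {ρ ρ′} → (∀ i → ρ i ≡ ρ′ i) → ∀ i → ext ρ i ≡ ext ρ′ i
  ext-cong h zero    = refl
  ext-cong h (suc i) = cong suc (h i)

  rename-cong : ∀ {ρ ρ′} → (∀ i → ρ i ≡ ρ′ i) → ∀ M → rename ρ M ≡ rename ρ′ M
  rename-cong h (var i)   = cong var (h i)
  rename-cong h (con c)   = refl
  rename-cong h (Pi A B)  = cong₂ Pi (rename-cong h A) (rename-cong (ext-cong h) B)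
  rename-cong h (lam A M) = cong₂ lam (rename-cong h A) (rename-cong (ext-cong h) M)
  rename-cong h (app M N) = cong₂ app (rename-cong h M) (rename-cong h N)

  exts-cong : ∀ {σ σ′} → (∀ i → σ i ≡ σ′ i) → ∀ i → exts σ i ≡ exts σ′ i
  exts-cong h zero    = refl
  exts-cong h (suc i) = cong wk (h i)

  subst-cong : ∀ {σ σ′} → (∀ i → σ i ≡ σ′ i) → ∀ M → subst σ M ≡ subst σ′ M
  subst-cong h (var i)   = h i
  subst-cong h (con c)   = refl
  subst-cong h (Pi A B)  = cong₂ Pi (subst-cong h A) (subst-cong (exts-cong h) B)
  subst-cong h (lam A M) = cong₂ lam (subst-cong h A) (subst-cong (exts-cong h) M)
  subst-cong h (app M N) = cong₂ app (subst-cong h M) (subst-cong h N)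

  ext-∘ : ∀ ρ ρ′ i → ext ρ (ext ρ′ i) ≡ ext (ρ ∘ ρ′) i
  ext-∘ ρ ρ′ zero    = refl
  ext-∘ ρ ρ′ (suc i) = refl

  rename-∘ : ∀ ρ ρ′ M → rename ρ (rename ρ′ M) ≡ rename (ρ ∘ ρ′) M
  rename-∘ ρ ρ′ (var i)   = refl
  rename-∘ ρ ρ′ (con c)   = refl
  rename-∘ ρ ρ′ (Pi A B)  = cong₂ Pi (rename-∘ ρ ρ′ A)
    (trans (rename-∘ (ext ρ) (ext ρ′) B) (rename-cong (ext-∘ ρ ρ′) B))
  rename-∘ ρ ρ′ (lam A M) = cong₂ lam (rename-∘ ρ ρ′ A)
    (trans (rename-∘ (ext ρ) (ext ρ′) M) (rename-cong (ext-∘ ρ ρ′) M))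
  rename-∘ ρ ρ′ (app M N) = cong₂ app (rename-∘ ρ ρ′ M) (rename-∘ ρ ρ′ N)

  exts-ext : ∀ σ ρ i → exts σ (ext ρ i) ≡ exts (σ ∘ ρ) i
  exts-ext σ ρ zero    = refl
  exts-ext σ ρ (suc i) = refl

  subst-rename : ∀ σ ρ M → subst σ (rename ρ M) ≡ subst (σ ∘ ρ) M
  subst-rename σ ρ (var i)   = refl
  subst-rename σ ρ (con c)   = refl
  subst-rename σ ρ (Pi A B)  = cong₂ Pi (subst-rename σ ρ A)
    (trans (subst-rename (exts σ) (ext ρ) B) (subst-cong (exts-ext σ ρ) B))
  subst-rename σ ρ (lam A M) = cong₂ lam (subst-rename σ ρ A)
    (trans (subst-rename (exts σ) (ext ρ) M) (subst-cong (exts-ext σ ρ) M))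
  subst-rename σ ρ (app M N) = cong₂ app (subst-rename σ ρ M) (subst-rename σ ρ N)

  rename-wk : ∀ ρ M → rename (ext ρ) (wk M) ≡ wk (rename ρ M)
  rename-wk ρ M = trans (rename-∘ (ext ρ) suc M) (sym (rename-∘ suc ρ M))

  rename-exts : ∀ ρ σ i → rename (ext ρ) (exts σ i) ≡ exts (rename ρ ∘ σ) i
  rename-exts ρ σ zero    = refl
  rename-exts ρ σ (suc i) = rename-wk ρ (σ i)

  rename-subst : ∀ ρ σ M → rename ρ (subst σ M) ≡ subst (rename ρ ∘ σ) M
  rename-subst ρ σ (var i)   = refl
  rename-subst ρ σ (con c)   = refl
  rename-subst ρ σ (Pi A B)  = cong₂ Pi (rename-subst ρ σ A)
    (trans (rename-subst (ext ρ) (exts σ) B) (subst-cong (rename-exts ρ σ) B))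
  rename-subst ρ σ (lam A M) = cong₂ lam (rename-subst ρ σ A)
    (trans (rename-subst (ext ρ) (exts σ) M) (subst-cong (rename-exts ρ σ) M))
  rename-subst ρ σ (app M N) = cong₂ app (rename-subst ρ σ M) (rename-subst ρ σ N)

  subst-wk : ∀ σ M → subst (exts σ) (wk M) ≡ wk (subst σ M)
  subst-wk σ M = trans (subst-rename (exts σ) suc M) (sym (rename-subst suc σ M))

  subst-exts : ∀ σ τ i → subst (exts σ) (exts τ i) ≡ exts (subst σ ∘ τ) i
  subst-exts σ τ zero    = refl
  subst-exts σ τ (suc i) = subst-wk σ (τ i)

  subst-∘ : ∀ σ τ M → subst σ (subst τ M) ≡ subst (subst σ ∘ τ) M
  subst-∘ σ τ (var i)   = refl
  subst-∘ σ τ (con c)   = refl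
  subst-∘ σ τ (Pi A B)  = cong₂ Pi (subst-∘ σ τ A)
    (trans (subst-∘ (exts σ) (exts τ) B) (subst-cong (subst-exts σ τ) B))
  subst-∘ σ τ (lam A M) = cong₂ lam (subst-∘ σ τ A)
    (trans (subst-∘ (exts σ) (exts τ) M) (subst-cong (subst-exts σ τ) M))
  subst-∘ σ τ (app M N) = cong₂ app (subst-∘ σ τ M) (subst-∘ σ τ N)

  exts-var : ∀ i → exts var i ≡ var i
  exts-var zero    = refl
  exts-var (suc i) = refl

  subst-var : ∀ M → subst var M ≡ M
  subst-var (var i)   = refl
  subst-var (con c)   = refl
  subst-var (Pi A B)  = cong₂ Pi (subst-var A) (trans (subst-cong exts-var B) (subst-var B))
  subst-var (lam A M) = cong₂ lam (subst-var A) (trans (subst-cong exts-var M) (subst-var M))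
  subst-var (app M N) = cong₂ app (subst-var M) (subst-var N)

  subst-[] : ∀ σ M N → subst σ (M [ N ]) ≡ subst (exts σ) M [ subst σ N ]
  subst-[] σ M N = begin
    subst σ (M [ N ])                         ≡⟨ subst-∘ σ (single N) M ⟩
    subst (subst σ ∘ single N) M              ≡⟨ subst-cong pointwise M ⟩
    subst (subst (single N′) ∘ exts σ) M      ≡⟨ sym (subst-∘ (single N′) (exts σ) M) ⟩
    subst (exts σ) M [ N′ ]                   ∎
    where
    open ≡-Reasoning
    N′ = subst σ N
    pointwise : ∀ i → subst σ (single N i) ≡ subst (single N′) (exts σ i)
    pointwise zero    = refl
    pointwise (suc i) = sym (trans (subst-rename (single N′) suc (σ i)) (subst-var (σ i)))

  rename-[] : ∀ ρ M N → rename ρ (M [ N ]) ≡ rename (ext ρ) M [ rename ρ N ]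
  rename-[] ρ M N = begin
    rename ρ (M [ N ])                        ≡⟨ rename-subst ρ (single N) M ⟩
    subst (rename ρ ∘ single N) M             ≡⟨ subst-cong pointwise M ⟩
    subst (single (rename ρ N) ∘ ext ρ) M     ≡⟨ sym (subst-rename (single (rename ρ N)) (ext ρ) M) ⟩
    rename (ext ρ) M [ rename ρ N ]           ∎
    where
    open ≡-Reasoning
    pointwise : ∀ i → rename ρ (single N i) ≡ single (rename ρ N) (ext ρ i)
    pointwise zero    = refl
    pointwise (suc i) = refl

  infix 4 _⇛_
  data _⇛_ : Term → Term → Set where
    pvar  : ∀ {i} → var i ⇛ var i
    pcon  : ∀ {c} → con c ⇛ con c
    pPi   : ∀ {A A′ B B′} → A ⇛ A′ → B ⇛ B′ → Pi A B ⇛ Pi A′ B′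
    plam  : ∀ {A A′ M M′} → A ⇛ A′ → M ⇛ M′ → lam A M ⇛ lam A′ M′
    papp  : ∀ {M M′ N N′} → M ⇛ M′ → N ⇛ N′ → app M N ⇛ app M′ N′
    pbeta : ∀ {A M M′ N N′} → M ⇛ M′ → N ⇛ N′ → app (lam A M) N ⇛ M′ [ N′ ]

  ⇛-refl : ∀ M → M ⇛ M
  ⇛-refl (var i)   = pvar
  ⇛-refl (con c)   = pcon
  ⇛-refl (Pi A B)  = pPi (⇛-refl A) (⇛-refl B)
  ⇛-refl (lam A M) = plam (⇛-refl A) (⇛-refl M)
  ⇛-refl (app M N) = papp (⇛-refl M) (⇛-refl N)

  →β⇒⇛ : ∀ {M N} → M →β N → M ⇛ N
  →β⇒⇛ (beta {M = M} {N})  = pbeta (⇛-refl M) (⇛-refl N)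
  →β⇒⇛ (Pi₁ {B = B} r)     = pPi (→β⇒⇛ r) (⇛-refl B)
  →β⇒⇛ (Pi₂ {A} r)         = pPi (⇛-refl A) (→β⇒⇛ r)
  →β⇒⇛ (lam₁ {M = M} r)    = plam (→β⇒⇛ r) (⇛-refl M)
  →β⇒⇛ (lam₂ {A} r)        = plam (⇛-refl A) (→β⇒⇛ r)
  →β⇒⇛ (app₁ {N = N} r)    = papp (→β⇒⇛ r) (⇛-refl N)
  →β⇒⇛ (app₂ {M} r)        = papp (⇛-refl M) (→β⇒⇛ r)

  ⇛⇒→β* : ∀ {M N} → M ⇛ N → Star _→β_ M N
  ⇛⇒→β* pvar        = ε
  ⇛⇒→β* pcon        = ε
  ⇛⇒→β* (pPi p q)   = gmap _ Pi₁ (⇛⇒→β* p) ◅◅ gmap _ Pi₂ (⇛⇒→β* q)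
  ⇛⇒→β* (plam p q)  = gmap _ lam₁ (⇛⇒→β* p) ◅◅ gmap _ lam₂ (⇛⇒→β* q)
  ⇛⇒→β* (papp p q)  = gmap _ app₁ (⇛⇒→β* p) ◅◅ gmap _ app₂ (⇛⇒→β* q)
  ⇛⇒→β* (pbeta p q) =
    gmap _ (app₁ ∘ lam₂) (⇛⇒→β* p) ◅◅ gmap _ app₂ (⇛⇒→β* q) ◅◅ beta ◅ ε

  ⇛-rename : ∀ ρ {M M′} → M ⇛ M′ → rename ρ M ⇛ rename ρ M′
  ⇛-rename ρ pvar       = pvar
  ⇛-rename ρ pcon       = pcon
  ⇛-rename ρ (pPi p q)  = pPi (⇛-rename ρ p) (⇛-rename (ext ρ) q)
  ⇛-rename ρ (plam p q) = plam (⇛-rename ρ p) (⇛-rename (ext ρ) q)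
  ⇛-rename ρ (papp p q) = papp (⇛-rename ρ p) (⇛-rename ρ q)
  ⇛-rename ρ (pbeta {M′ = M′} {N′ = N′} p q)
    rewrite rename-[] ρ M′ N′ = pbeta (⇛-rename (ext ρ) p) (⇛-rename ρ q)

  ⇛-exts : ∀ {σ τ} → (∀ i → σ i ⇛ τ i) → ∀ i → exts σ i ⇛ exts τ i
  ⇛-exts h zero    = pvar
  ⇛-exts h (suc i) = ⇛-rename suc (h i)

  ⇛-subst : ∀ {σ τ} → (∀ i → σ i ⇛ τ i) → ∀ {M M′} → M ⇛ M′ → subst σ M ⇛ subst τ M′
  ⇛-subst h pvar       = h _
  ⇛-subst h pcon       = pcon
  ⇛-subst h (pPi p q)  = pPi (⇛-subst h p) (⇛-subst (⇛-exts h) q)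
  ⇛-subst h (plam p q) = plam (⇛-subst h p) (⇛-subst (⇛-exts h) q)
  ⇛-subst h (papp p q) = papp (⇛-subst h p) (⇛-subst h q)
  ⇛-subst {τ = τ} h (pbeta {M′ = M′} {N′ = N′} p q)
    rewrite subst-[] τ M′ N′ = pbeta (⇛-subst (⇛-exts h) p) (⇛-subst h q)

  ⇛-[] : ∀ {M M′ N N′} → M ⇛ M′ → N ⇛ N′ → M [ N ] ⇛ M′ [ N′ ]
  ⇛-[] p q = ⇛-subst (λ { zero → q ; (suc i) → pvar }) p

  develop : Term → Term
  develop (var i)           = var i
  develop (con c)           = con c
  develop (Pi A B)          = Pi (develop A) (develop B)
  develop (lam A M)         = lam (develop A) (develop M)
  develop (app (lam A M) N) = develop M [ develop N ]
  develop (app M N)         = app (develop M) (develop N)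

  ⇛-develop : ∀ {M N} → M ⇛ N → N ⇛ develop M
  ⇛-develop pvar                             = pvar
  ⇛-develop pcon                             = pcon
  ⇛-develop (pPi p q)                        = pPi (⇛-develop p) (⇛-develop q)
  ⇛-develop (plam p q)                       = plam (⇛-develop p) (⇛-develop q)
  ⇛-develop (papp {M = var _} p q)           = papp (⇛-develop p) (⇛-develop q)
  ⇛-develop (papp {M = con _} p q)           = papp (⇛-develop p) (⇛-develop q)
  ⇛-develop (papp {M = Pi _ _} p q)          = papp (⇛-develop p) (⇛-develop q)
  ⇛-develop (papp {M = app _ _} p q)         = papp (⇛-develop p) (⇛-develop q)
  ⇛-develop (papp {M = lam _ _} (plam _ p) q) = pbeta (⇛-develop p) (⇛-develop q)
  ⇛-develop (pbeta p q)                      = ⇛-[] (⇛-develop p) (⇛-develop q)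

  ⇛-strip : ∀ {M N P} → M ⇛ N → Star _⇛_ M P → ∃ λ Q → Star _⇛_ N Q × P ⇛ Q
  ⇛-strip {N = N} p ε = N , ε , p
  ⇛-strip p (q ◅ qs) with ⇛-strip (⇛-develop q) qs
  ... | Q , s , r = Q , ⇛-develop p ◅ s , r

  ⇛-confluent : Confluent _⇛_
  ⇛-confluent {C = P} ε qs = P , qs , ε
  ⇛-confluent (p ◅ ps) qs with ⇛-strip p qs
  ... | Q , s , r with ⇛-confluent ps s
  ... | R , a , b = R , a , r ◅ b

  →β-confluent : Confluent _→β_
  →β-confluent r s with ⇛-confluent (map →β⇒⇛ r) (map →β⇒⇛ s)
  ... | Q , a , b = Q , (⇛⇒→β* ⋆) a , (⇛⇒→β* ⋆) b

  con-normal : ∀ {c} → IsNormalForm _→β_ (con c)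
  con-normal (_ , ())

  con-=β-injective : ∀ {a b} → con a =β con b → a ≡ b
  con-=β-injective a=b with conf⇒unf →β-confluent con-normal con-normal a=b
  ... | refl = refl

module _ (𝒮 : Spec) where
  open Spec 𝒮
  open Terms Const
  private
    module P = PTS 𝒮
    module H = HPTS 𝒮 NoSchemes

  IsAxiom : Term → Term → Set
  IsAxiom M A = Σ Const λ c → Σ Const λ s → (M ≡ con c) × (A ≡ con s) × Axiom c s

  NoRuleOnAxiomSort : Set
  NoRuleOnAxiomSort = ∀ c s₁ → Axiom c s₁ → ∀ s₂ s₃ → ¬ Rule s₁ s₂ s₃

  IsAxiom-conversion : ∀ {M A B C} → IsAxiom M A → IsAxiom B C → A =β B → IsAxiom M B
  IsAxiom-conversion (c , s , refl , refl , c∶s) (_ , _ , refl , refl , _) s=b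
    with con-=β-injective s=b
  ... | refl = c , s , refl , refl , c∶s

  IsAxiom-type-irreducible : ∀ {M A B} → IsAxiom M A → ¬ (A →β B)
  IsAxiom-type-irreducible (_ , _ , _ , refl , _) ()

  IsAxiom-subject-irreducible : ∀ {M A N} → IsAxiom M A → ¬ (M →β N)
  IsAxiom-subject-irreducible (_ , _ , refl , _ , _) ()

  hpts-theorem⇒IsAxiom : ∀ {M A} → H.⊢ M ∶ A → IsAxiom M A
  hpts-theorem⇒IsAxiom (H.axiom c∶s) = _ , _ , refl , refl , c∶s
  hpts-theorem⇒IsAxiom (H.application ⊢M _) with hpts-theorem⇒IsAxiom ⊢M
  ... | _ , _ , _ , () , _
  hpts-theorem⇒IsAxiom (H.conversion _ ⊢M ⊢B A=B) =
    IsAxiom-conversion (hpts-theorem⇒IsAxiom ⊢M) (hpts-theorem⇒IsAxiom ⊢B) A=B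
  hpts-theorem⇒IsAxiom (H.type-reduction ⊢M A→B) =
    ⊥-elim (IsAxiom-type-irreducible (hpts-theorem⇒IsAxiom ⊢M) A→B)
  hpts-theorem⇒IsAxiom (H.subject-reduction ⊢M M→N) =
    ⊥-elim (IsAxiom-subject-irreducible (hpts-theorem⇒IsAxiom ⊢M) M→N)

  pts-theorem⇒IsAxiom : NoRuleOnAxiomSort → ∀ {M A} → P._⊢_∶_ [] M A → IsAxiom M A
  pts-theorem⇒IsAxiom _ (P.axiom c∶s) = _ , _ , refl , refl , c∶s
  pts-theorem⇒IsAxiom noRule (P.application ⊢M _) with pts-theorem⇒IsAxiom noRule ⊢M
  ... | _ , _ , _ , () , _
  pts-theorem⇒IsAxiom noRule (P.abstraction _ _ ⊢Π) with pts-theorem⇒IsAxiom noRule ⊢Π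
  ... | _ , _ , () , _ , _
  pts-theorem⇒IsAxiom noRule (P.product _ ⊢A rule) with pts-theorem⇒IsAxiom noRule ⊢A
  ... | c , s₁ , refl , refl , c∶s₁ = ⊥-elim (noRule c s₁ c∶s₁ _ _ rule)
  pts-theorem⇒IsAxiom noRule (P.conversion _ ⊢M ⊢B A=B) =
    IsAxiom-conversion (pts-theorem⇒IsAxiom noRule ⊢M) (pts-theorem⇒IsAxiom noRule ⊢B) A=B

  IsAxiom⇒hpts-theorem : ∀ {M A} → IsAxiom M A → H.⊢ M ∶ A
  IsAxiom⇒hpts-theorem (_ , _ , refl , refl , c∶s) = H.axiom c∶s

  IsAxiom⇒pts-theorem : ∀ {M A} → IsAxiom M A → P._⊢_∶_ [] M A
  IsAxiom⇒pts-theorem (_ , _ , refl , refl , c∶s) = P.axiom c∶s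

theorem9 : (𝒮 : Spec) →
    (∀ c s₁ → Spec.Axiom 𝒮 c s₁ → ∀ s₂ s₃ → ¬ Spec.Rule 𝒮 s₁ s₂ s₃) →
    (∀ M A → ((PTS._⊢_∶_ 𝒮 [] M A) ⇔ (HPTS.⊢_∶_ 𝒮 NoSchemes M A)))
    × (∀ M A → (HPTS.⊢_∶_ 𝒮 NoSchemes M A) ⇔
         (Σ (Spec.Const 𝒮) λ c → Σ (Spec.Const 𝒮) λ s →
            (M ≡ Terms.con c) × (A ≡ Terms.con s) × Spec.Axiom 𝒮 c s))
theorem9 𝒮 noRule =
  (λ M A → mk⇔ (IsAxiom⇒hpts-theorem 𝒮 ∘ pts-theorem⇒IsAxiom 𝒮 noRule)
               (IsAxiom⇒pts-theorem 𝒮 ∘ hpts-theorem⇒IsAxiom 𝒮)) ,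
  (λ M A → mk⇔ (hpts-theorem⇒IsAxiom 𝒮) (IsAxiom⇒hpts-theorem 𝒮))
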